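{- Let $n\geq 1$. Let $A_0,\dots,A_{n-1},X_0,\dots,X_{n-1}$ be pairwise distinct propositional variables, $\alpha_i:=LA_i$, $\underline{\alpha}:=(\alpha_{n-1},\dots,\alpha_0)$, $\underline X:=(X_{n-1},\dots,X_0)$, and \[\mathrm{counter}_{\mathrm{S4\times S5},n}:=\mathrm{persistent}(\underline X)\wedge(\underline{\alpha}=\mathrm{bin}_n(0))\wedge K\Box\Bigl(\bigwedge_{k=0}^{n-1}\bigl(\mathrm{rightmost\_zero}(\underline{\alpha},k)\rightarrow L\bigl((\underline X=\underline{\alpha},>k)\wedge\mathrm{rightmost\_one}(\underline X,k)\wedge\Diamond(\underline X=\underline{\alpha})\bigr)\bigr)\Bigr).\] Then: (1) $\mathrm{counter}_{\mathrm{S4\times S5},n}$ is $\mathrm{S4\times S5}$-satisfiable. (2) For every $\mathrm{S4\times S5}$-commutator model of $\mathrm{counter}_{\mathrm{S4\times S5},n}$ and every point $p_0$ in it with $p_0\models\mathrm{counter}_{\mathrm{S4\times S5},n}$, there exist points $p_1,\dots,p_{2^n-1}$ and $p'_0,\dots,p'_{2^n-2}$ such that $p_i\models(\underline{\alpha}=\mathrm{bin}_n(i))$ for $0\le i\le 2^n-1$, and for $0\le i\le 2^n-2$: $p_i\stackrel{L}{\to}p'_i$, $p'_i\stackrel{\Diamond}{\to}p_{i+1}$ and $p'_i\models(\underline X=\mathrm{bin}_n(i+1))$.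
   Context: Bimodal formulas are built from propositional variables with $\neg,\wedge,K,\Box$; $L:=\neg K\neg$, $\Diamond:=\neg\Box\neg$; $K\psi$ (resp. $\Box\psi$) holds at $p$ iff $\psi$ holds at all $\stackrel{L}{\to}$- (resp. $\stackrel{\Diamond}{\to}$-)successors of $p$. An $\mathrm{S4\times S5}$-commutator model is $(W,\stackrel{\Diamond}{\to},\stackrel{L}{\to},\sigma)$ with $\stackrel{L}{\to}$ an equivalence relation, $\stackrel{\Diamond}{\to}$ reflexive and transitive, left commutativity (if $p\stackrel{\Diamond}{\to}q\stackrel{L}{\to}r$ then $p\stackrel{L}{\to}s\stackrel{\Diamond}{\to}r$ for some $s$) and right commutativity (if $p\stackrel{L}{\to}q\stackrel{\Diamond}{\to}r$ then $p\stackrel{\Diamond}{\to}s\stackrel{L}{\to}r$ for some $s$); a formula is $\mathrm{S4\times S5}$-satisfiable iff it holds at a point of such a model. $\mathrm{Ones}(i)$ is the set of positions (counted from $0$ at the right) of ones in the binary representation of $i$. For vectors $\underline F=(F_{l-1},\dots,F_0)$, $\underline G=(G_{l-1},\dots,G_0)$: $(\underline F=\underline G,>k):=\bigwedge_{h=k+1}^{l-1}(F_h\leftrightarrow G_h)$; $(\underline F=\underline G):=(\underline F=\underline G,>-1)$; $(\underline F=\mathrm{bin}_l(i)):=\bigwedge_{k\in\mathrm{Ones}(i)}F_k\wedge\bigwedge_{k\in\{0,\dots,l-1\}\setminus\mathrm{Ones}(i)}\neg F_k$ for $0\le i<2^l$; $\mathrm{rightmost\_zero}(\underline F,k):=\neg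 F_k\wedge\bigwedge_{h<k}F_h$; $\mathrm{rightmost\_one}(\underline F,k):=F_k\wedge\bigwedge_{h<k}\neg F_h$; $\mathrm{persistent}(\underline F):=\bigwedge_{h=0}^{l-1}K(\Box F_h\vee\Box\neg F_h)$ (empty conjunctions are true). -}

module Defs where

open import Data.Nat using (ℕ; zero; suc; _<_; _<ᵇ_; _%_; _/_; _≡ᵇ_)
open import Data.Bool using (Bool; true; false; if_then_else_)
open import Data.Product using (_×_; Σ)
open import Data.Empty using (⊥)
open import Relation.Nullary using (¬_)
open import Relation.Binary.PropositionalEquality using (_≡_; _≢_)

infixr 6 _∧'_
data Fm : Set where
  var  : ℕ → Fm
  ¬'_  : Fm → Fm
  _∧'_ : Fm → Fm → Fm
  K    : Fm → Fm
  □    : Fm → Fm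

L : Fm → Fm
L φ = ¬' K (¬' φ)

◇ : Fm → Fm
◇ φ = ¬' □ (¬' φ)

_∨'_ : Fm → Fm → Fm
φ ∨' ψ = ¬' ((¬' φ) ∧' (¬' ψ))

_⇒'_ : Fm → Fm → Fm
φ ⇒' ψ = ¬' (φ ∧' (¬' ψ))

_⇔'_ : Fm → Fm → Fm
φ ⇔' ψ = (φ ⇒' ψ) ∧' (ψ ⇒' φ)

⊤' : Fm
⊤' = ¬' (var 0 ∧' (¬' var 0))

⋀ : (ℕ → Fm) → ℕ → Fm
⋀ f zero    = ⊤'
⋀ f (suc l) = ⋀ f l ∧' f l

bit : ℕ → ℕ → Bool
bit i zero    = i % 2 ≡ᵇ 1
bit i (suc k) = bit (i / 2) k

-- Formula vectors  F = (F_{l-1},…,F_0)  represented as  F : ℕ → Fm  with length l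

-- (F = G, > k) := ⋀_{h=k+1}^{l-1} (F_h ↔ G_h)
eqAbove : ℕ → (ℕ → Fm) → (ℕ → Fm) → ℕ → Fm
eqAbove l F G k = ⋀ (λ h → if k <ᵇ h then (F h ⇔' G h) else ⊤') l

eqVec : ℕ → (ℕ → Fm) → (ℕ → Fm) → Fm
eqVec l F G = ⋀ (λ h → F h ⇔' G h) l

eqBin : ℕ → (ℕ → Fm) → ℕ → Fm
eqBin l F i = ⋀ (λ k → if bit i k then F k else ¬' F k) l

rightmostZero : (ℕ → Fm) → ℕ → Fm
rightmostZero F k = (¬' F k) ∧' ⋀ F k

rightmostOne : (ℕ → Fm) → ℕ → Fm
rightmostOne F k = F k ∧' ⋀ (λ h → ¬' F h) k

persistent : ℕ → (ℕ → Fm) → Fm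
persistent l F = ⋀ (λ h → K (□ (F h) ∨' □ (¬' F h))) l

-- counter_{S4×S5,n}, with A_i = var (a i), X_i = var (x i)

counter : ℕ → (ℕ → ℕ) → (ℕ → ℕ) → Fm
counter n a x =
  persistent n X ∧'
  eqBin n α 0 ∧'
  K (□ (⋀ (λ k → rightmostZero α k ⇒'
                   L (eqAbove n X α k ∧' rightmostOne X k ∧' ◇ (eqVec n X α))) n))
  where
    α : ℕ → Fm
    α i = L (var (a i))
    X : ℕ → Fm
    X i = var (x i)

PairwiseDistinct : ℕ → (ℕ → ℕ) → (ℕ → ℕ) → Set
PairwiseDistinct n a x =
  (∀ i j → i < n → j < n → a i ≡ a j → i ≡ j) ×
  (∀ i j → i < n → j < n → x i ≡ x j → i ≡ j) ×
  (∀ i j → i < n → j < n → a i ≢ x j)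

record Model : Set₁ where
  field
    W   : Set
    _→◇_ : W → W → Set
    _→L_ : W → W → Set
    σ   : ℕ → W → Set

record IsCommutatorModel (M : Model) : Set where
  open Model M
  field
    L-refl  : ∀ p → p →L p
    L-sym   : ∀ {p q} → p →L q → q →L p
    L-trans : ∀ {p q r} → p →L q → q →L r → p →L r
    ◇-refl  : ∀ p → p →◇ p
    ◇-trans : ∀ {p q r} → p →◇ q → q →◇ r → p →◇ r
    left-comm  : ∀ {p q r} → p →◇ q → q →L r → Σ W (λ s → (p →L s) × (s →◇ r))
    right-comm : ∀ {p q r} → p →L q → q →◇ r → Σ W (λ s → (p →◇ s) × (s →L r))

_,_⊨_ : (M : Model) → Model.W M → Fm → Set
M , p ⊨ var v   = Model.σ M v p
M , p ⊨ (¬' φ)  = ¬ (M , p ⊨ φ)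
M , p ⊨ (φ ∧' ψ) = (M , p ⊨ φ) × (M , p ⊨ ψ)
M , p ⊨ K φ     = ∀ q → Model._→L_ M p q → M , q ⊨ φ
M , p ⊨ □ φ     = ∀ q → Model._→◇_ M p q → M , q ⊨ φ

S4×S5-satisfiable : Fm → Set₁
S4×S5-satisfiable φ =
  Σ Model (λ M → IsCommutatorModel M × Σ (Model.W M) (λ p → M , p ⊨ φ))

module Submission where

-- In a commutator model of the formula at
-- p₀, every point reachable from p₀ by an L-step followed by a ◇-step is in
-- the scope of the leading K□.  At such a point q with α = bin(i) and
-- i + 1 < 2ⁿ, let k be the rightmost zero of i; the k-th conjunct yields an
-- L-successor q′ whose X-vector is bin(i + 1) (bits above k copied from α,
-- which is L-invariant, bit k set and lower bits cleared), and a ◇-successor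
-- q″ of q′ where α = X.  Persistence of X transports X = bin(i + 1) from q′
-- to q″, so α = bin(i + 1) at q″; by left commutativity q″ is again
-- reachable.  Iterating this step from p₀ builds the chain p₀, p′₀, p₁, …
--
-- On ℕ × ℕ, a point (t , u) stores the α-value t and the
-- X-value u; L keeps t and ◇ increases t while keeping u.  This is a
-- commutator model, and counter holds at (0 , 0): the demanded L-successor of
-- (t , u) is (t , t + 1), whose ◇-successor (t + 1 , t + 1) has α = X.

open import Defs
open import Level using (0ℓ)
open import Axiom.ExcludedMiddle using (ExcludedMiddle)
open import Data.Nat using (ℕ; zero; suc; _≤_; _<_; _^_; _/_; _<ᵇ_; _<?_; z≤n; s≤s)
open import Data.Nat.Properties
  using (≤-refl; ≤-trans; <-trans; <-cmp; n<1+n; n≤1+n; *-comm; m<1+n⇒m<n∨m≡n; m<n⇒m<1+n; <⇒<ᵇ; <ᵇ⇒<)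
open import Data.Nat.DivMod using (m/n≡1+[m∸n]/n; m<n*o⇒m/o<n)
open import Data.Bool using (Bool; true; false; T; if_then_else_)
open import Data.Product using (_×_; _,_; proj₁; proj₂; Σ)
open import Data.Sum using (_⊎_; inj₁; inj₂)
open import Data.Empty using (⊥; ⊥-elim)
open import Relation.Nullary using (¬_; yes; no)
open import Relation.Binary using (tri<; tri≈; tri>)
open import Relation.Binary.PropositionalEquality using (_≡_; refl; sym; trans; cong; subst)

false≢true : {b : Bool} → b ≡ false → b ≡ true → ⊥
false≢true refl ()

half-suc-suc : ∀ i → suc (suc i) / 2 ≡ suc (i / 2)
half-suc-suc i = m/n≡1+[m∸n]/n {suc (suc i)} {2} (s≤s (s≤s z≤n))

suc-of-even : ∀ i → bit i 0 ≡ false → bit (suc i) 0 ≡ true × suc i / 2 ≡ i / 2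
suc-of-even zero          _ = refl , refl
suc-of-even (suc zero)    ()
suc-of-even (suc (suc i)) even with suc-of-even i even
... | set , half = set , trans (half-suc-suc (suc i)) (trans (cong suc half) (sym (half-suc-suc i)))

suc-of-odd : ∀ i → bit i 0 ≡ true → bit (suc i) 0 ≡ false × suc i / 2 ≡ suc (i / 2)
suc-of-odd zero          ()
suc-of-odd (suc zero)    _ = refl , refl
suc-of-odd (suc (suc i)) odd with suc-of-odd i odd
... | clear , half =
  clear , trans (half-suc-suc (suc i)) (trans (cong suc half) (cong suc (sym (half-suc-suc i))))

RightmostZero : ℕ → ℕ → Set
RightmostZero i k = bit i k ≡ false × (∀ h → h < k → bit i h ≡ true)

record Increments (i k : ℕ) : Set where
  field
    sets   : bit (suc i) k ≡ true
    clears : ∀ h → h < k → bit (suc i) h ≡ false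
    keeps  : ∀ h → k < h → bit (suc i) h ≡ bit i h
open Increments

increment-bits : ∀ {i} k → RightmostZero i k → Increments i k
increment-bits {i} zero (zero-at-k , _) = record
  { sets   = proj₁ (suc-of-even i zero-at-k)
  ; clears = λ _ ()
  ; keeps  = λ { (suc h) _ → cong (λ j → bit j h) (proj₂ (suc-of-even i zero-at-k)) } }
increment-bits {i} (suc k) (zero-at-k , ones-below) = record
  { sets   = subst (λ j → bit j k ≡ true) (sym carry) (sets inc)
  ; clears = λ { zero _ → cleared
               ; (suc h) (s≤s h<k) → subst (λ j → bit j h ≡ false) (sym carry) (clears inc h h<k) }
  ; keeps  = λ { (suc h) (s≤s k<h) → trans (cong (λ j → bit j h) carry) (keeps inc h k<h) } }
  where
    cleared = proj₁ (suc-of-odd i (ones-below 0 (s≤s z≤n)))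
    carry   = proj₂ (suc-of-odd i (ones-below 0 (s≤s z≤n)))
    inc : Increments (i / 2) k
    inc = increment-bits k (zero-at-k , λ h h<k → ones-below (suc h) (s≤s h<k))

rightmost-zero-exists : ∀ n i → suc i < 2 ^ n → Σ ℕ λ k → k < n × RightmostZero i k
rightmost-zero-exists zero    i (s≤s ())
rightmost-zero-exists (suc n) i lt with bit i 0 in bit₀
... | false = 0 , s≤s z≤n , bit₀ , λ _ ()
... | true with rightmost-zero-exists n (i / 2) half-bound
  where
    half-bound : suc (i / 2) < 2 ^ n
    half-bound = subst (_< 2 ^ n) (proj₂ (suc-of-odd i bit₀))
                   (m<n*o⇒m/o<n {suc i} {2 ^ n} {2} (subst (suc i <_) (*-comm 2 (2 ^ n)) lt))
... | k , k<n , zero-at-k , ones-below =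
  suc k , s≤s k<n , zero-at-k , λ { zero _ → bit₀ ; (suc h) (s≤s h<k) → ones-below h h<k }

module Semantics (M : Model) where
  open Model M

  ⊤'-holds : ∀ {p} → M , p ⊨ ⊤'
  ⊤'-holds (v , ¬v) = ¬v v

  ⋀-elim : ∀ {p} f {l k} → M , p ⊨ ⋀ f l → k < l → M , p ⊨ f k
  ⋀-elim f {suc l} (below , last) k<l with m<1+n⇒m<n∨m≡n k<l
  ... | inj₁ k<l′ = ⋀-elim f below k<l′
  ... | inj₂ refl = last

  ⋀-intro : ∀ {p f} l → (∀ k → k < l → M , p ⊨ f k) → M , p ⊨ ⋀ f l
  ⋀-intro zero    _   = ⊤'-holds
  ⋀-intro (suc l) all = ⋀-intro l (λ k k<l → all k (m<n⇒m<1+n k<l)) , all l ≤-refl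

  L-intro : ∀ {p q} φ → p →L q → M , q ⊨ φ → M , p ⊨ L φ
  L-intro {q = q} _ p→q φ-at-q none = none q p→q φ-at-q

  ◇-intro : ∀ {p q} φ → p →◇ q → M , q ⊨ φ → M , p ⊨ ◇ φ
  ◇-intro {q = q} _ p→q φ-at-q none = none q p→q φ-at-q

  ∨-introˡ : ∀ {p φ ψ} → M , p ⊨ φ → M , p ⊨ (φ ∨' ψ)
  ∨-introˡ φ-holds (¬φ , _) = ¬φ φ-holds

  ∨-introʳ : ∀ {p φ ψ} → M , p ⊨ ψ → M , p ⊨ (φ ∨' ψ)
  ∨-introʳ ψ-holds (_ , ¬ψ) = ¬ψ ψ-holds

  ⇔-intro : ∀ {p φ ψ} → (M , p ⊨ φ → M , p ⊨ ψ) → (M , p ⊨ ψ → M , p ⊨ φ) → M , p ⊨ (φ ⇔' ψ)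
  ⇔-intro to from = (λ (φ-holds , ¬ψ) → ¬ψ (to φ-holds)) , (λ (ψ-holds , ¬φ) → ¬φ (from ψ-holds))

  ⇔-sym : ∀ {p φ ψ} → M , p ⊨ (φ ⇔' ψ) → M , p ⊨ (ψ ⇔' φ)
  ⇔-sym (to , from) = from , to

  record Matches (p : W) (F : ℕ → Fm) (i h : ℕ) : Set where
    constructor matches
    field
      if-set   : bit i h ≡ true → M , p ⊨ F h
      if-unset : bit i h ≡ false → ¬ (M , p ⊨ F h)
  open Matches public

  matches-reindex : ∀ {p F i j h} → bit i h ≡ bit j h → Matches p F i h → Matches p F j h
  matches-reindex same (matches s u) = matches (λ e → s (trans same e)) (λ e → u (trans same e))

  matches-set : ∀ {p F i h} → Matches p F i h → M , p ⊨ F h → bit i h ≡ true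
  matches-set {i = i} {h} m F-holds with bit i h in e
  ... | true  = refl
  ... | false = ⊥-elim (if-unset m e F-holds)

  matches-unset : ∀ {p F i h} → Matches p F i h → ¬ (M , p ⊨ F h) → bit i h ≡ false
  matches-unset {i = i} {h} m ¬F with bit i h in e
  ... | true  = ⊥-elim (¬F (if-set m e))
  ... | false = refl

  matches-⇔ : ∀ {p F G i h} → Matches p F i h → Matches p G i h → M , p ⊨ (F h ⇔' G h)
  matches-⇔ {F = F} {G} {i} {h} mF mG with bit i h in e
  ... | true  = ⇔-intro {φ = F h} {ψ = G h} (λ _ → if-set mG e) (λ _ → if-set mF e)
  ... | false = ⇔-intro {φ = F h} {ψ = G h} (λ F-holds → ⊥-elim (if-unset mF e F-holds))
                        (λ G-holds → ⊥-elim (if-unset mG e G-holds))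

  eqBin-intro : ∀ {p l F i} → (∀ h → h < l → Matches p F i h) → M , p ⊨ eqBin l F i
  eqBin-intro {p} {l} {F} {i} all = ⋀-intro l literal
    where
      literal : ∀ h → h < l → M , p ⊨ (if bit i h then F h else ¬' F h)
      literal h h<l with bit i h in e
      ... | true  = if-set (all h h<l) e
      ... | false = if-unset (all h h<l) e

  eqBin-elim : ∀ {p l F i h} → M , p ⊨ eqBin l F i → h < l → Matches p F i h
  eqBin-elim {F = F} {i} {h} holds h<l
    with bit i h in e | ⋀-elim (λ h → if bit i h then F h else ¬' F h) holds h<l
  ... | true  | F-holds = matches (λ _ → F-holds) (λ unset → ⊥-elim (false≢true unset e))
  ... | false | ¬F      = matches (λ set → ⊥-elim (false≢true e set)) (λ _ → ¬F)

  eqAbove-intro : ∀ {p l F G k} → (∀ h → k < h → h < l → M , p ⊨ (F h ⇔' G h)) →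
                  M , p ⊨ eqAbove l F G k
  eqAbove-intro {p} {l} {F} {G} {k} above = ⋀-intro l conjunct
    where
      conjunct : ∀ h → h < l → M , p ⊨ (if k <ᵇ h then (F h ⇔' G h) else ⊤')
      conjunct h h<l with k <ᵇ h in e
      ... | true  = above h (<ᵇ⇒< k h (subst T (sym e) _)) h<l
      ... | false = ⊤'-holds

  eqAbove-elim : ∀ {p l F G k h} → M , p ⊨ eqAbove l F G k → k < h → h < l → M , p ⊨ (F h ⇔' G h)
  eqAbove-elim {F = F} {G} {k} {h} holds k<h h<l
    with k <ᵇ h | <⇒<ᵇ k<h | ⋀-elim (λ h → if k <ᵇ h then (F h ⇔' G h) else ⊤') holds h<l
  ... | true | _ | iff = iff

  record SameTruth (p q : W) (φ : Fm) : Set where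
    field
      keeps-true  : M , p ⊨ φ → M , q ⊨ φ
      keeps-false : ¬ (M , p ⊨ φ) → ¬ (M , q ⊨ φ)
  open SameTruth public

  matches-transfer : ∀ {p q F i h} → SameTruth p q (F h) → Matches p F i h → Matches q F i h
  matches-transfer same (matches s u) = matches (λ e → keeps-true same (s e)) (λ e → keeps-false same (u e))

-- Classical rules: reading off witnesses of L, ◇ and ∨ needs excluded middle.
module Classical (em : ExcludedMiddle 0ℓ) (M : Model) where
  open Model M
  open Semantics M

  stable : {P : Set} → ¬ ¬ P → P
  stable {P} ¬¬P with em {P}
  ... | yes P-holds = P-holds
  ... | no ¬P       = ⊥-elim (¬¬P ¬P)

  witness : {R : W → W → Set} {P : W → Set} {p : W} →
            ¬ (∀ q → R p q → ¬ P q) → Σ W λ q → R p q × P q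
  witness none-fails = stable λ ¬exists → none-fails λ q r P-holds → ¬exists (q , r , P-holds)

  L-witness : ∀ {p} φ → M , p ⊨ L φ → Σ W λ q → p →L q × M , q ⊨ φ
  L-witness _ = witness {R = _→L_}

  ◇-witness : ∀ {p} φ → M , p ⊨ ◇ φ → Σ W λ q → p →◇ q × M , q ⊨ φ
  ◇-witness _ = witness {R = _→◇_}

  ∨-elim : ∀ {p φ ψ} → M , p ⊨ (φ ∨' ψ) → (M , p ⊨ φ) ⊎ (M , p ⊨ ψ)
  ∨-elim {p} {φ} disj with em {M , p ⊨ φ}
  ... | yes φ-holds = inj₁ φ-holds
  ... | no ¬φ       = inj₂ (stable λ ¬ψ → disj (¬φ , ¬ψ))

  ⇔-matches : ∀ {p F G i h} → M , p ⊨ (F h ⇔' G h) → Matches p G i h → Matches p F i h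
  ⇔-matches (F⇒G , G⇒F) (matches s u) =
    matches (λ e → stable λ ¬F → G⇒F (s e , ¬F)) (λ e F-holds → F⇒G (F-holds , u e))

module Counting (em : ExcludedMiddle 0ℓ) (n : ℕ) (a x : ℕ → ℕ)
                (M : Model) (isModel : IsCommutatorModel M)
                (p₀ : Model.W M) (H : M , p₀ ⊨ counter n a x) where
  open Model M
  open IsCommutatorModel isModel
  open Semantics M
  open Classical em M

  α X : ℕ → Fm
  α h = L (var (a h))
  X h = var (x h)

  ψ : ℕ → Fm
  ψ k = eqAbove n X α k ∧' rightmostOne X k ∧' ◇ (eqVec n X α)

  counting-clause : ℕ → Fm
  counting-clause k = rightmostZero α k ⇒' L (ψ k)

  -- The scope of the K□ in counter.
  Reachable : W → Set
  Reachable q = Σ W λ s → p₀ →L s × s →◇ q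

  root-reachable : Reachable p₀
  root-reachable = p₀ , L-refl p₀ , ◇-refl p₀

  reachable-◇ : ∀ {q q′} → Reachable q → q →◇ q′ → Reachable q′
  reachable-◇ (s , p₀→s , s→q) q→q′ = s , p₀→s , ◇-trans s→q q→q′

  -- Left commutativity turns s →◇ q →L q′ into s →L s′ →◇ q′.
  reachable-L : ∀ {q q′} → Reachable q → q →L q′ → Reachable q′
  reachable-L (s , p₀→s , s→q) q→q′ with left-comm s→q q→q′
  ... | s′ , s→s′ , s′→q′ = s′ , L-trans p₀→s s→s′ , s′→q′

  L-invariant : ∀ {q q′ φ} → q →L q′ → SameTruth q q′ (L φ)
  L-invariant q→q′ = record
    { keeps-true  = λ Lφ none → Lφ (λ r q→r → none r (L-trans (L-sym q→q′) q→r))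
    ; keeps-false = λ ¬Lφ Lφ → ¬Lφ (λ none → Lφ (λ r q′→r → none r (L-trans q→q′ q′→r))) }

  -- persistent(X): below a reachable point the X-bits do not change along ◇.
  X-persists : ∀ {q q′ h} → Reachable q → q →◇ q′ → h < n → SameTruth q q′ (X h)
  X-persists {q} {q′} {h} (s , p₀→s , s→q) q→q′ h<n
    with ∨-elim {φ = □ (X h)} {ψ = □ (¬' X h)} (⋀-elim (λ h → K (□ (X h) ∨' □ (¬' X h))) (proj₁ H) h<n s p₀→s)
  ... | inj₁ always = record
    { keeps-true  = λ _ → always q′ (◇-trans s→q q→q′)
    ; keeps-false = λ ¬X _ → ¬X (always q s→q) }
  ... | inj₂ never = record
    { keeps-true  = λ X-holds → ⊥-elim (never q s→q X-holds)
    ; keeps-false = λ _ → never q′ (◇-trans s→q q→q′) }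

  rightmostZero-holds : ∀ {q i k} → M , q ⊨ eqBin n α i → RightmostZero i k → k < n →
                        M , q ⊨ rightmostZero α k
  rightmostZero-holds αi (zero-at-k , ones-below) k<n =
    if-unset (eqBin-elim αi k<n) zero-at-k ,
    ⋀-intro _ (λ h h<k → if-set (eqBin-elim αi (<-trans h<k k<n)) (ones-below h h<k))

  counting-demand : ∀ {q k} → Reachable q → k < n → M , q ⊨ rightmostZero α k → M , q ⊨ L (ψ k)
  counting-demand {q} (s , p₀→s , s→q) k<n rz =
    stable λ ¬Lψ → ⋀-elim counting-clause (proj₂ (proj₂ H) s p₀→s q s→q) k<n (rz , ¬Lψ)

  X-counts : ∀ {q q′ i k} → q →L q′ → M , q ⊨ eqBin n α i → RightmostZero i k → k < n →
             M , q′ ⊨ eqAbove n X α k → M , q′ ⊨ rightmostOne X k → M , q′ ⊨ eqBin n X (suc i)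
  X-counts {q′ = q′} {i} {k} q→q′ αi rz k<n above (X-at-k , zeros-below) = eqBin-intro bit-h
    where
      inc = increment-bits k rz
      bit-h : ∀ h → h < n → Matches q′ X (suc i) h
      bit-h h h<n with <-cmp h k
      ... | tri< h<k _ _ = matches (λ e → ⊥-elim (false≢true (clears inc h h<k) e))
                                   (λ _ → ⋀-elim (λ h → ¬' X h) zeros-below h<k)
      ... | tri≈ _ refl _ = matches (λ _ → X-at-k) (λ e → ⊥-elim (false≢true e (sets inc)))
      ... | tri> _ _ k<h = matches-reindex (sym (keeps inc h k<h))
                             (⇔-matches (eqAbove-elim above k<h h<n)
                               (matches-transfer (L-invariant q→q′) (eqBin-elim αi h<n)))

  α-copies : ∀ {q q′ j} → Reachable q → q →◇ q′ → M , q ⊨ eqBin n X j →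
             M , q′ ⊨ eqVec n X α → M , q′ ⊨ eqBin n α j
  α-copies r q→q′ Xj α=X = eqBin-intro λ h h<n →
    ⇔-matches (⇔-sym {φ = X h} {ψ = α h} (⋀-elim (λ h → X h ⇔' α h) α=X h<n))
      (matches-transfer (X-persists r q→q′ h<n) (eqBin-elim Xj h<n))

  -- One step of the counter from a point q (only required to count while i + 1 < 2ⁿ).
  record Increment (i : ℕ) (q : W) : Set where
    field
      mid next : W
      to-mid   : q →L mid
      to-next  : mid →◇ next
      correct  : suc i < 2 ^ n → M , mid ⊨ eqBin n X (suc i) × M , next ⊨ eqBin n α (suc i)
  open Increment

  counting-step : ∀ {q i} → Reachable q → M , q ⊨ eqBin n α i → suc i < 2 ^ n → Increment i q
  counting-step {q} {i} r αi lt with rightmost-zero-exists n i lt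
  ... | k , k<n , rz with L-witness (ψ k) (counting-demand r k<n (rightmostZero-holds αi rz k<n))
  ... | q′ , q→q′ , above , ones , α=X-later with ◇-witness (eqVec n X α) α=X-later
  ... | q″ , q′→q″ , α=X = record
    { mid = q′ ; next = q″ ; to-mid = q→q′ ; to-next = q′→q″
    ; correct = λ _ → X-next , α-copies (reachable-L r q→q′) q′→q″ X-next α=X }
    where X-next = X-counts q→q′ αi rz k<n above ones

  record ChainPoint (i : ℕ) : Set where
    field
      point     : W
      reachable : Reachable point
      value     : i < 2 ^ n → M , point ⊨ eqBin n α i
  open ChainPoint

  increment : ∀ {i} (c : ChainPoint i) → Increment i (point c)
  increment {i} c with suc i <? 2 ^ n
  ... | yes lt = counting-step (reachable c) (value c (<-trans (n<1+n i) lt)) lt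
  ... | no ¬lt = record { mid = point c ; next = point c ; to-mid = L-refl _ ; to-next = ◇-refl _
                        ; correct = λ lt → ⊥-elim (¬lt lt) }

  chain : (i : ℕ) → ChainPoint i
  chain zero    = record { point = p₀ ; reachable = root-reachable ; value = λ _ → proj₁ (proj₂ H) }
  chain (suc i) = record
    { point     = next step
    ; reachable = reachable-◇ (reachable-L (reachable (chain i)) (to-mid step)) (to-next step)
    ; value     = λ lt → proj₂ (correct step lt) }
    where step = increment (chain i)

  counting-chain :
    Σ (ℕ → W) (λ p → Σ (ℕ → W) (λ p′ →
      (p 0 ≡ p₀) ×
      (∀ i → i < 2 ^ n → M , p i ⊨ eqBin n α i) ×
      (∀ i → suc i < 2 ^ n → (p i →L p′ i) × (p′ i →◇ p (suc i)) × M , p′ i ⊨ eqBin n X (suc i))))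
  counting-chain =
    (λ i → point (chain i)) , (λ i → mid (increment (chain i))) , refl ,
    (λ i → value (chain i)) ,
    λ i lt → to-mid (increment (chain i)) , to-next (increment (chain i)) ,
             proj₁ (correct (increment (chain i)) lt)

module Canonical (n : ℕ) (a x : ℕ → ℕ) (distinct : PairwiseDistinct n a x) where

  a-injective = proj₁ distinct
  x-injective = proj₁ (proj₂ distinct)
  a≢x         = proj₂ (proj₂ distinct)

  valuation : ℕ → ℕ × ℕ → Set
  valuation v p = (Σ ℕ λ h → h < n × a h ≡ v × bit (proj₁ p) h ≡ true) ⊎
                  (Σ ℕ λ h → h < n × x h ≡ v × bit (proj₂ p) h ≡ true)

  canonical : Model
  canonical = record
    { W    = ℕ × ℕ
    ; _→◇_ = λ p q → proj₁ p ≤ proj₁ q × proj₂ p ≡ proj₂ q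
    ; _→L_ = λ p q → proj₁ p ≡ proj₁ q
    ; σ    = valuation }

  canonical-commutator : IsCommutatorModel canonical
  canonical-commutator = record
    { L-refl     = λ _ → refl
    ; L-sym      = sym
    ; L-trans    = trans
    ; ◇-refl     = λ _ → ≤-refl , refl
    ; ◇-trans    = λ (t≤ , u≡) (t≤′ , u≡′) → ≤-trans t≤ t≤′ , trans u≡ u≡′
    ; left-comm  = λ { {p} {r = r} (t≤ , _) t≡ → (proj₁ p , proj₂ r) , refl , subst (proj₁ p ≤_) t≡ t≤ , refl }
    ; right-comm = λ { {p} {r = r} t≡ (t≤ , _) → (proj₁ r , proj₂ p) , (subst (_≤ proj₁ r) (sym t≡) t≤ , refl) , refl } }

  open Semantics canonical

  α X : ℕ → Fm
  α h = L (var (a h))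
  X h = var (x h)

  ψ : ℕ → Fm
  ψ k = eqAbove n X α k ∧' rightmostOne X k ∧' ◇ (eqVec n X α)

  -- Distinctness of the variables: A_h is true exactly at the set bits h of t.
  a-value : ∀ {p h} → h < n → valuation (a h) p → bit (proj₁ p) h ≡ true
  a-value h<n (inj₁ (h′ , h′<n , same , set)) with a-injective h′ _ h′<n h<n same
  ... | refl = set
  a-value h<n (inj₂ (h′ , h′<n , same , _)) = ⊥-elim (a≢x _ h′ h<n h′<n (sym same))

  x-value : ∀ {p h} → h < n → valuation (x h) p → bit (proj₂ p) h ≡ true
  x-value h<n (inj₂ (h′ , h′<n , same , set)) with x-injective h′ _ h′<n h<n same
  ... | refl = set
  x-value h<n (inj₁ (h′ , h′<n , same , _)) = ⊥-elim (a≢x h′ _ h′<n h<n same)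

  α-matches : ∀ {t u h} → h < n → Matches (t , u) α t h
  α-matches {t} {u} {h} h<n = matches
    (λ set → L-intro {t , u} {t , u} (var (a h)) refl (inj₁ (h , h<n , refl , set)))
    (λ unset Lα → Lα (λ { q refl A-holds → false≢true unset (a-value {q} h<n A-holds) }))

  X-matches : ∀ {t u h} → h < n → Matches (t , u) X u h
  X-matches {t} {u} {h} h<n = matches
    (λ set → inj₂ (h , h<n , refl , set))
    (λ unset X-holds → false≢true unset (x-value {t , u} h<n X-holds))

  X-persistent : ∀ {h} → h < n → (q : ℕ × ℕ) → canonical , q ⊨ (□ (X h) ∨' □ (¬' X h))
  X-persistent {h} h<n (t , u) with bit u h in e
  ... | true  = ∨-introˡ {φ = □ (X h)} {ψ = □ (¬' X h)} λ { q (_ , refl) → if-set (X-matches {proj₁ q} h<n) e }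
  ... | false = ∨-introʳ {φ = □ (X h)} {ψ = □ (¬' X h)} λ { q (_ , refl) → if-unset (X-matches {proj₁ q} h<n) e }

  rightmostZero-read : ∀ {t u k} → k < n → canonical , (t , u) ⊨ rightmostZero α k → RightmostZero t k
  rightmostZero-read {u = u} k<n (¬α-at-k , α-below) =
    matches-unset (α-matches {u = u} k<n) ¬α-at-k ,
    λ h h<k → matches-set (α-matches {u = u} (<-trans h<k k<n)) (⋀-elim α α-below h<k)

  ψ-holds : ∀ {t k} → RightmostZero t k → k < n → canonical , (t , suc t) ⊨ ψ k
  ψ-holds {t} {k} rz k<n =
    eqAbove-intro (λ h k<h h<n → matches-⇔ (matches-reindex (keeps inc h k<h) (X-matches h<n)) (α-matches h<n)) ,
    (if-set (X-matches k<n) (sets inc) ,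
     ⋀-intro k (λ h h<k → if-unset (X-matches (<-trans h<k k<n)) (clears inc h h<k))) ,
    ◇-intro {q = suc t , suc t} (eqVec n X α) (n≤1+n t , refl)
      (⋀-intro n (λ h h<n → matches-⇔ (X-matches h<n) (α-matches h<n)))
    where inc = increment-bits k rz

  counting-holds : ∀ {k} → k < n → (q : ℕ × ℕ) → canonical , q ⊨ (rightmostZero α k ⇒' L (ψ k))
  counting-holds {k} k<n (t , u) (rz , ¬Lψ) =
    ¬Lψ (L-intro {t , u} {t , suc t} (ψ k) refl (ψ-holds (rightmostZero-read k<n rz) k<n))

  origin-satisfies : canonical , (0 , 0) ⊨ counter n a x
  origin-satisfies =
    ⋀-intro n (λ h h<n q _ → X-persistent h<n q) ,
    eqBin-intro (λ h h<n → α-matches h<n) ,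
    λ _ _ q _ → ⋀-intro n (λ k k<n → counting-holds k<n q)

  satisfiable : S4×S5-satisfiable (counter n a x)
  satisfiable = canonical , canonical-commutator , (0 , 0) , origin-satisfies

mainTheorem7 : ExcludedMiddle 0ℓ →
    (n : ℕ) → 1 ≤ n → (a x : ℕ → ℕ) → PairwiseDistinct n a x →
      S4×S5-satisfiable (counter n a x) ×
      ((M : Model) → IsCommutatorModel M →
        (p₀ : Model.W M) → M , p₀ ⊨ counter n a x →
        Σ (ℕ → Model.W M) (λ p → Σ (ℕ → Model.W M) (λ p′ →
          (p 0 ≡ p₀) ×
          (∀ i → i < 2 ^ n → M , p i ⊨ eqBin n (λ k → L (var (a k))) i) ×
          (∀ i → suc i < 2 ^ n →
             Model._→L_ M (p i) (p′ i) ×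
             Model._→◇_ M (p′ i) (p (suc i)) ×
             M , p′ i ⊨ eqBin n (λ k → var (x k)) (suc i)))))
mainTheorem7 em n _ a x distinct =
  Canonical.satisfiable n a x distinct ,
  λ M isModel p₀ holds → Counting.counting-chain em n a x M isModel p₀ holds
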